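{- Let $X$ be a graph and let $S$ be a unique-neighbourhood clique in $X$. Then $S$ is an orbit-restrictor in $X$.
   Context: All graphs are simple. $N(v,X)$ is the set of neighbours of $v$ in $X$, and $\langle A\rangle$ denotes the subgraph induced on a vertex set $A$. For a vertex $v$, $[v]=\{w\in V(X):\langle N(w,X)\rangle\cong\langle N(v,X)\rangle\}$. A clique $S$ of $X$ is a unique-neighbourhood clique if for every clique $S'\neq S$ of $X$ with $|S'|=|S|$, $\langle\bigcap_{w\in S'}N(w,X)\rangle\not\cong\langle\bigcap_{w\in S}N(w,X)\rangle$. A clique $S$ in $X$ is an orbit-restrictor if for every $v\in S$: (i) $[v]\subseteq S$; and (ii) for all $v_1,v_2\in[v]$ (not necessarily distinct) and every isomorphism $\phi:\langle N(v_1,X)\rangle\to\langle N(v_2,X)\rangle$, one has $\phi(S\setminus\{v_1\})=S\setminus\{v_2\}$. -}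

module Defs where

open import Data.Nat using (ℕ)
open import Data.Bool using (Bool; true; false; not; _∨_)
open import Data.Fin using (Fin)
open import Data.Fin.Subset using (Subset; _∈_; ∣_∣)
open import Data.Vec using (tabulate; lookup)
open import Data.List using (allFin)
open import Data.Bool.ListAction using (all)
open import Data.Product using (Σ; ∃; _×_; proj₁)
open import Function.Bundles using (_↔_; Inverse)
open import Relation.Binary.PropositionalEquality using (_≡_; _≢_)
open import Relation.Nullary using (¬_)

record Graph (n : ℕ) : Set where
  field
    adj    : Fin n → Fin n → Bool
    sym    : ∀ u v → adj u v ≡ adj v u
    irrefl : ∀ v → adj v v ≡ false
open Graph public

module _ {n : ℕ} (X : Graph n) where

  Nbr : Fin n → Subset n
  Nbr v = tabulate (adj X v)

  -- ⋂_{w ∈ S} N(w, X)   (the whole vertex set when S is empty)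
  CommonNbr : Subset n → Subset n
  CommonNbr S = tabulate λ u → all (λ w → not (lookup S w) ∨ adj X w u) (allFin n)

  Elem : Subset n → Set
  Elem A = Σ (Fin n) λ x → x ∈ A

  InducedIso : Subset n → Subset n → Set
  InducedIso A B =
    Σ (Elem A ↔ Elem B) λ φ →
      ∀ (x y : Elem A) →
        adj X (proj₁ x) (proj₁ y) ≡ adj X (proj₁ (Inverse.to φ x)) (proj₁ (Inverse.to φ y))

  InClass : Fin n → Fin n → Set
  InClass v w = InducedIso (Nbr w) (Nbr v)

  IsClique : Subset n → Set
  IsClique S = ∀ u v → u ∈ S → v ∈ S → u ≢ v → adj X u v ≡ true

  IsUniqueNbrClique : Subset n → Set
  IsUniqueNbrClique S =
    IsClique S ×
    (∀ S' → IsClique S' → S' ≢ S → ∣ S' ∣ ≡ ∣ S ∣ →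
      ¬ InducedIso (CommonNbr S') (CommonNbr S))

  -- φ(S ∖ {v₁}) = S ∖ {v₂}, stated literally as equality of the image with S ∖ {v₂}
  ImageEq : (S : Subset n) (v₁ v₂ : Fin n) → InducedIso (Nbr v₁) (Nbr v₂) → Set
  ImageEq S v₁ v₂ φ =
    ∀ (y : Fin n) →
      ((y ∈ S × y ≢ v₂) →
         ∃ λ (x : Elem (Nbr v₁)) →
           (proj₁ x ∈ S × proj₁ x ≢ v₁) × proj₁ (Inverse.to (proj₁ φ) x) ≡ y)
      ×
      ((∃ λ (x : Elem (Nbr v₁)) →
           (proj₁ x ∈ S × proj₁ x ≢ v₁) × proj₁ (Inverse.to (proj₁ φ) x) ≡ y) →
         (y ∈ S × y ≢ v₂))

  IsOrbitRestrictor : Subset n → Set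
  IsOrbitRestrictor S =
    IsClique S ×
    (∀ v → v ∈ S →
      (∀ w → InClass v w → w ∈ S) ×
      (∀ v₁ v₂ → InClass v v₁ → InClass v v₂ →
        (φ : InducedIso (Nbr v₁) (Nbr v₂)) → ImageEq S v₁ v₂ φ))

{-# OPTIONS --safe #-}
module Submission where

-- Fix v₁ ∈ S and an isomorphism φ : ⟨N(v₁)⟩ ≅ ⟨N(v₂)⟩. As S is a clique, S ∖ {v₁} ⊆ N(v₁), so
-- σ = (v₁ ↦ v₂, x ↦ φ x) is an injection of S, and together σ and φ preserve adjacency
-- between S and N(v₁). Hence S′ = σ(S) is a clique with |S′| = |S|, and, since the common
-- neighbourhood of S (resp. S′) lies inside N(v₁) (resp. N(v₂)), φ restricts to an isomorphism
-- between the common neighbourhoods of S and S′. Uniqueness forces S′ = S: so v₂ ∈ S, which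
-- gives [v] ⊆ S, and φ(S ∖ {v₁}) = S′ ∖ {v₂} = S ∖ {v₂}.

open import Defs hiding (sym)
open import Data.Nat using (ℕ; suc)
open import Data.Bool using (Bool; true; false; not; _∨_; T)
open import Data.Bool.Properties using (T-≡) renaming (_≟_ to _≟ᴮ_)
open import Data.Fin using (Fin; zero; suc; _≟_)
open import Data.Fin.Properties using (any?)
open import Data.Fin.Permutation using (↔⇒≡)
open import Data.Fin.Subset using (Subset; inside; outside; _∈_; _∉_; _⊆_; ∣_∣)
open import Data.List using (allFin)
import Data.List.Relation.Unary.All as All
open import Data.List.Relation.Unary.All.Properties using (all⁺; all⁻)
open import Data.List.Membership.Propositional.Properties using (∈-allFin)
open import Data.Product using (Σ; ∃; _×_; _,_; proj₁; proj₂)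
open import Data.Vec using (_∷_; here; there; tabulate; lookup)
open import Data.Vec.Properties using (lookup∘tabulate; []=⇒lookup; lookup⇒[]=; ≡-dec)
open import Data.Vec.Properties.WithK using ([]=-irrelevant)
open import Function using (_∘_)
open import Function.Bundles using (_↔_; _⇔_; mk⇔; Inverse; Injection; Equivalence; mk↔ₛ′)
open import Function.Definitions using (Injective)
open import Function.Properties.Inverse using (↔-sym; ↔-trans; Inverse⇒Injection)
open import Relation.Binary.PropositionalEquality
open import Relation.Nullary using (yes; no; does; proof; Reflects; invert; contradiction)
open import Relation.Nullary.Decidable using (dec-true; decidable-stable)

private variable
  n m : ℕ
  A : Subset n

proj₁-injective : {x y : Σ (Fin n) (_∈ A)} → proj₁ x ≡ proj₁ y → x ≡ y
proj₁-injective {x = x , p} {y = .x , q} refl = cong (x ,_) ([]=-irrelevant p q)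

∈-tabulate⁺ : {f : Fin n → Bool} {x : Fin n} → f x ≡ true → x ∈ tabulate f
∈-tabulate⁺ {f = f} {x} fx = lookup⇒[]= x (tabulate f) (trans (lookup∘tabulate f x) fx)

∈-tabulate⁻ : {f : Fin n → Bool} {x : Fin n} → x ∈ tabulate f → f x ≡ true
∈-tabulate⁻ {f = f} {x} x∈ = trans (sym (lookup∘tabulate f x)) ([]=⇒lookup x∈)

members↔Fin∣∣ : (A : Subset n) → Σ (Fin n) (_∈ A) ↔ Fin ∣ A ∣
members↔Fin∣∣ A = mk↔ₛ′ (index A) (member A) (index∘member A) (member∘index A)
  where
  suc-member : ∀ {n b} {A : Subset n} → Σ (Fin n) (_∈ A) → Σ (Fin (suc n)) (_∈ b ∷ A)
  suc-member (x , x∈A) = suc x , there x∈A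

  index : (A : Subset n) → Σ (Fin n) (_∈ A) → Fin ∣ A ∣
  index (inside  ∷ A) (zero  , here)      = zero
  index (inside  ∷ A) (suc x , there x∈A) = suc (index A (x , x∈A))
  index (outside ∷ A) (suc x , there x∈A) = index A (x , x∈A)

  member : (A : Subset n) → Fin ∣ A ∣ → Σ (Fin n) (_∈ A)
  member (inside  ∷ A) zero    = zero , here
  member (inside  ∷ A) (suc i) = suc-member (member A i)
  member (outside ∷ A) i       = suc-member (member A i)

  index∘member : (A : Subset n) (i : Fin ∣ A ∣) → index A (member A i) ≡ i
  index∘member (inside  ∷ A) zero    = refl
  index∘member (inside  ∷ A) (suc i) = cong suc (index∘member A i)
  index∘member (outside ∷ A) i       = index∘member A i

  member∘index : (A : Subset n) (x : Σ (Fin n) (_∈ A)) → member A (index A x) ≡ x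
  member∘index (inside  ∷ A) (zero  , here)      = refl
  member∘index (inside  ∷ A) (suc x , there x∈A) = cong suc-member (member∘index A (x , x∈A))
  member∘index (outside ∷ A) (suc x , there x∈A) = cong suc-member (member∘index A (x , x∈A))

∣∣-cong-↔ : {A : Subset n} {B : Subset m} → Σ (Fin n) (_∈ A) ↔ Σ (Fin m) (_∈ B) → ∣ A ∣ ≡ ∣ B ∣
∣∣-cong-↔ {A = A} {B} A↔B =
  ↔⇒≡ (↔-trans (↔-sym (members↔Fin∣∣ A)) (↔-trans A↔B (members↔Fin∣∣ B)))

module _ {A : Subset n} (f : Σ (Fin n) (_∈ A) → Fin m) where

  image : Subset m
  image = tabulate λ y → does (any? λ i → f (Inverse.from (members↔Fin∣∣ A) i) ≟ y)

  ∈-image⁺ : (x : Σ (Fin n) (_∈ A)) → f x ∈ image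
  ∈-image⁺ x = ∈-tabulate⁺ (dec-true (any? _) (Inverse.to A↔ x , cong f (Inverse.strictlyInverseʳ A↔ x)))
    where A↔ = members↔Fin∣∣ A

  ∈-image⁻ : {y : Fin m} → y ∈ image → ∃ λ x → f x ≡ y
  ∈-image⁻ {y} y∈ with (i , fi≡y) ← invert (subst (Reflects _) (∈-tabulate⁻ y∈) (proof (any? _))) =
    Inverse.from (members↔Fin∣∣ A) i , fi≡y

  ∣image∣≡∣∣ : Injective _≡_ _≡_ f → ∣ image ∣ ≡ ∣ A ∣
  ∣image∣≡∣∣ f-injective = sym (∣∣-cong-↔ (mk↔ₛ′ to from to∘from from∘to))
    where
    to : Σ (Fin n) (_∈ A) → Σ (Fin m) (_∈ image)
    to x = f x , ∈-image⁺ x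
    from : Σ (Fin m) (_∈ image) → Σ (Fin n) (_∈ A)
    from (_ , y∈) = proj₁ (∈-image⁻ y∈)
    to∘from : ∀ y → to (from y) ≡ y
    to∘from (_ , y∈) = proj₁-injective (proj₂ (∈-image⁻ y∈))
    from∘to : ∀ x → from (to x) ≡ x
    from∘to x = f-injective (proj₂ (∈-image⁻ (∈-image⁺ x)))

module _ (X : Graph n) where

  ∈-Nbr⁺ : {v x : Fin n} → adj X v x ≡ true → x ∈ Nbr X v
  ∈-Nbr⁺ = ∈-tabulate⁺

  ∈-Nbr⁻ : {v x : Fin n} → x ∈ Nbr X v → adj X v x ≡ true
  ∈-Nbr⁻ = ∈-tabulate⁻

  v∉Nbr[v] : {v : Fin n} → v ∉ Nbr X v
  v∉Nbr[v] {v} v∈ with () ← trans (sym (irrefl X v)) (∈-Nbr⁻ v∈)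

  clique⊆Nbr : {S : Subset n} {v w : Fin n} → IsClique X S → v ∈ S → w ∈ S → w ≢ v → w ∈ Nbr X v
  clique⊆Nbr S-clique v∈S w∈S w≢v = ∈-Nbr⁺ (S-clique _ _ v∈S w∈S (w≢v ∘ sym))

  ∈-CommonNbr⁺ : {S : Subset n} {u : Fin n} → (∀ {w} → w ∈ S → adj X w u ≡ true) → u ∈ CommonNbr X S
  ∈-CommonNbr⁺ {S} {u} adj-S = ∈-tabulate⁺ (Equivalence.to T-≡ (all⁻ _ (All.universal adj-w (allFin n))))
    where
    adj-w : ∀ w → T (not (lookup S w) ∨ adj X w u)
    adj-w w with lookup S w in w∈S
    ... | false = _
    ... | true  = Equivalence.from T-≡ (adj-S (lookup⇒[]= w S w∈S))

  ∈-CommonNbr⁻ : {S : Subset n} {u w : Fin n} → u ∈ CommonNbr X S → w ∈ S → adj X w u ≡ true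
  ∈-CommonNbr⁻ {S} {u} {w} u∈ w∈S
    with adj-w ← All.lookup (all⁺ _ (allFin n) (Equivalence.from T-≡ (∈-tabulate⁻ u∈))) (∈-allFin w)
    rewrite []=⇒lookup w∈S = Equivalence.to T-≡ adj-w

  CommonNbr⊆Nbr : {S : Subset n} {v : Fin n} → v ∈ S → CommonNbr X S ⊆ Nbr X v
  CommonNbr⊆Nbr v∈S u∈ = ∈-Nbr⁺ (∈-CommonNbr⁻ u∈ v∈S)

  InducedIso-sym : {A B : Subset n} → InducedIso X A B → InducedIso X B A
  InducedIso-sym (ψ , preserves) = ↔-sym ψ , λ x y → begin
    adj X (proj₁ x) (proj₁ y)
      ≡⟨ cong₂ (λ x′ y′ → adj X (proj₁ x′) (proj₁ y′)) (strictlyInverseˡ x) (strictlyInverseˡ y) ⟨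
    adj X (proj₁ (to (from x))) (proj₁ (to (from y)))
      ≡⟨ preserves (from x) (from y) ⟨
    adj X (proj₁ (from x)) (proj₁ (from y)) ∎
    where
    open Inverse ψ
    open ≡-Reasoning

  InducedIso-restrict : {A B A′ B′ : Subset n} (φ : InducedIso X A B) → A′ ⊆ A → B′ ⊆ B →
                        (∀ x → proj₁ x ∈ A′ ⇔ proj₁ (Inverse.to (proj₁ φ) x) ∈ B′) →
                        InducedIso X A′ B′
  InducedIso-restrict {A′ = A′} {B′} (ψ , preserves) A′⊆A B′⊆B A′⇔B′ =
    mk↔ₛ′ to′ from′ to∘from from∘to , λ x y → preserves (widen A′⊆A x) (widen A′⊆A y)
    where
    open Inverse ψ

    widen : {C C′ : Subset n} → C′ ⊆ C → Elem X C′ → Elem X C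
    widen C′⊆C (x , x∈C′) = x , C′⊆C x∈C′

    to′ : Elem X A′ → Elem X B′
    to′ x = proj₁ (to (widen A′⊆A x)) , Equivalence.to (A′⇔B′ _) (proj₂ x)

    from′ : Elem X B′ → Elem X A′
    from′ y = proj₁ (from (widen B′⊆B y)) ,
              Equivalence.from (A′⇔B′ _) (subst (_∈ B′) (sym (cong proj₁ (strictlyInverseˡ _))) (proj₂ y))

    to∘from : ∀ y → to′ (from′ y) ≡ y
    to∘from y = proj₁-injective (cong proj₁ (trans (cong to (proj₁-injective refl)) (strictlyInverseˡ _)))

    from∘to : ∀ x → from′ (to′ x) ≡ x
    from∘to x = proj₁-injective (cong proj₁ (trans (cong from (proj₁-injective refl)) (strictlyInverseʳ _)))

  module Transport {S : Subset n} (S-clique : IsClique X S) {v₁ v₂ : Fin n} (v₁∈S : v₁ ∈ S)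
                   (φ : InducedIso X (Nbr X v₁) (Nbr X v₂)) where
    open Inverse (proj₁ φ)

    σ : Elem X S → Fin n
    σ (x , x∈S) with x ≟ v₁
    ... | yes _    = v₂
    ... | no x≢v₁ = proj₁ (to (x , clique⊆Nbr S-clique v₁∈S x∈S x≢v₁))

    S′ : Subset n
    S′ = image σ

    φ[S∖v₁] : Fin n → Set
    φ[S∖v₁] y = ∃ λ (u : Elem X (Nbr X v₁)) → (proj₁ u ∈ S × proj₁ u ≢ v₁) × proj₁ (to u) ≡ y

    to≢v₂ : (u : Elem X (Nbr X v₁)) → proj₁ (to u) ≢ v₂
    to≢v₂ u u↦v₂ = v∉Nbr[v] (subst (_∈ Nbr X v₂) u↦v₂ (proj₂ (to u)))

    σ-v₁ : σ (v₁ , v₁∈S) ≡ v₂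
    σ-v₁ with v₁ ≟ v₁
    ... | yes _     = refl
    ... | no v₁≢v₁ = contradiction refl v₁≢v₁

    σ-Nbr : ∀ {x} (x∈S : x ∈ S) (x∈N : x ∈ Nbr X v₁) → σ (x , x∈S) ≡ proj₁ (to (x , x∈N))
    σ-Nbr {x} x∈S x∈N with x ≟ v₁
    ... | yes refl = contradiction x∈N v∉Nbr[v]
    ... | no _     = cong (proj₁ ∘ to) (proj₁-injective refl)

    σ-φ[S∖v₁] : ∀ x → σ x ≢ v₂ → φ[S∖v₁] (σ x)
    σ-φ[S∖v₁] (x , x∈S) σx≢v₂ with x ≟ v₁
    ... | yes _    = contradiction refl σx≢v₂
    ... | no x≢v₁ = (x , _) , (x∈S , x≢v₁) , refl

    σ-injective : Injective _≡_ _≡_ σ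
    σ-injective {x , _} {y , _} σx≡σy with x ≟ v₁ | y ≟ v₁
    ... | yes refl | yes refl = proj₁-injective refl
    ... | yes _    | no _     = contradiction (sym σx≡σy) (to≢v₂ _)
    ... | no _     | yes _    = contradiction σx≡σy (to≢v₂ _)
    ... | no _     | no _     =
      proj₁-injective (cong proj₁ (Injection.injective (Inverse⇒Injection (proj₁ φ)) (proj₁-injective σx≡σy)))

    adj-σ : ∀ x (u : Elem X (Nbr X v₁)) → adj X (σ x) (proj₁ (to u)) ≡ adj X (proj₁ x) (proj₁ u)
    adj-σ (x , _) u with x ≟ v₁
    ... | yes refl = trans (∈-Nbr⁻ (proj₂ (to u))) (sym (∈-Nbr⁻ (proj₂ u)))
    ... | no _     = sym (proj₂ φ _ u)

    v₂-adj-σ : ∀ x → proj₁ x ≢ v₁ → adj X v₂ (σ x) ≡ true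
    v₂-adj-σ (x , _) x≢v₁ with x ≟ v₁
    ... | yes x≡v₁ = contradiction x≡v₁ x≢v₁
    ... | no _     = ∈-Nbr⁻ (proj₂ (to _))

    σ-adjacent : ∀ x x′ → proj₁ x ≢ proj₁ x′ → adj X (σ x) (σ x′) ≡ true
    σ-adjacent x (x′ , x′∈S) x≢x′ with x′ ≟ v₁
    ... | no _     = trans (adj-σ x _) (S-clique _ _ (proj₂ x) x′∈S x≢x′)
    ... | yes refl = trans (Graph.sym X _ _) (v₂-adj-σ x x≢x′)

    v₂∈S′ : v₂ ∈ S′
    v₂∈S′ = subst (_∈ S′) σ-v₁ (∈-image⁺ σ (v₁ , v₁∈S))

    φ[S∖v₁]⊆S′ : ∀ {y} → φ[S∖v₁] y → y ∈ S′
    φ[S∖v₁]⊆S′ ((x , x∈N) , (x∈S , _) , refl) = subst (_∈ S′) (σ-Nbr x∈S x∈N) (∈-image⁺ σ (x , x∈S))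

    ∣S′∣≡∣S∣ : ∣ S′ ∣ ≡ ∣ S ∣
    ∣S′∣≡∣S∣ = ∣image∣≡∣∣ σ σ-injective

    S′-clique : IsClique X S′
    S′-clique _ _ w∈S′ w′∈S′ w≢w′
      with x , refl ← ∈-image⁻ σ w∈S′ | x′ , refl ← ∈-image⁻ σ w′∈S′ =
      σ-adjacent x x′ (w≢w′ ∘ cong σ ∘ proj₁-injective)

    CommonNbr-iso : InducedIso X (CommonNbr X S) (CommonNbr X S′)
    CommonNbr-iso = InducedIso-restrict φ (CommonNbr⊆Nbr v₁∈S) (CommonNbr⊆Nbr v₂∈S′)
                                        λ u → mk⇔ (forth u) (back u)
      where
      forth : ∀ u → proj₁ u ∈ CommonNbr X S → proj₁ (to u) ∈ CommonNbr X S′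
      forth u u∈CN = ∈-CommonNbr⁺ λ w∈S′ →
        let x , σx≡w = ∈-image⁻ σ w∈S′
        in subst (λ w → adj X w (proj₁ (to u)) ≡ true) σx≡w
                 (trans (adj-σ x u) (∈-CommonNbr⁻ u∈CN (proj₂ x)))
      back : ∀ u → proj₁ (to u) ∈ CommonNbr X S′ → proj₁ u ∈ CommonNbr X S
      back u to-u∈CN = ∈-CommonNbr⁺ λ w∈S →
        trans (sym (adj-σ (_ , w∈S) u)) (∈-CommonNbr⁻ to-u∈CN (∈-image⁺ σ (_ , w∈S)))

    restricts : S′ ≡ S → ImageEq X S v₁ v₂ φ
    restricts S′≡S y = forth , back
      where
      forth : y ∈ S × y ≢ v₂ → φ[S∖v₁] y
      forth (y∈S , y≢v₂) with x , refl ← ∈-image⁻ σ (subst (y ∈_) (sym S′≡S) y∈S) = σ-φ[S∖v₁] x y≢v₂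
      back : φ[S∖v₁] y → y ∈ S × y ≢ v₂
      back y∈φ[S∖v₁]@(u , _ , refl) = subst (_ ∈_) S′≡S (φ[S∖v₁]⊆S′ y∈φ[S∖v₁]) , to≢v₂ u

  module _ {S : Subset n} (S-unique : IsUniqueNbrClique X S) {v₁ v₂ : Fin n} (v₁∈S : v₁ ∈ S)
           (φ : InducedIso X (Nbr X v₁) (Nbr X v₂)) where
    open Transport (proj₁ S-unique) v₁∈S φ

    S′≡S : S′ ≡ S
    S′≡S = decidable-stable (≡-dec _≟ᴮ_ S′ S) λ S′≢S →
      proj₂ S-unique S′ S′-clique S′≢S ∣S′∣≡∣S∣ (InducedIso-sym CommonNbr-iso)

    uniqueNbrClique-closed : v₂ ∈ S
    uniqueNbrClique-closed = subst (v₂ ∈_) S′≡S v₂∈S′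

    uniqueNbrClique-restricts : ImageEq X S v₁ v₂ φ
    uniqueNbrClique-restricts = restricts S′≡S

lemma2p6 : ∀ {n : ℕ} (X : Graph n) (S : Subset n) →
    IsUniqueNbrClique X S → IsOrbitRestrictor X S
lemma2p6 X S S-unique = proj₁ S-unique , λ v v∈S →
  (λ w w∈[v] → uniqueNbrClique-closed X S-unique v∈S (InducedIso-sym X w∈[v])) ,
  (λ v₁ v₂ v₁∈[v] _ φ → uniqueNbrClique-restricts X S-unique
                          (uniqueNbrClique-closed X S-unique v∈S (InducedIso-sym X v₁∈[v])) φ)
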